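{- In any execution of Algorithm A, at the end of Step 4 every correct process has $|\text{accepted}|\le N+\left\lfloor \frac{t^2}{N-2t}\right\rfloor$.
   Context: System model: $N$ processes in a fully connected synchronous message-passing network with reliable channels; a receiver knows the label of the link on which a message arrived but not the sender's identifier; each correct process has a unique identifier initially known only to itself; up to $t$ processes are Byzantine (arbitrary behavior); throughout, $N>3t$. "Broadcast" means send to all $N$ links (including a self-loop). Id selection phase of Algorithm A (each correct process). Step 1: broadcast $\langle ID, my\_id\rangle$; Ids $:=$ set of identifiers received in ID messages. Step 2: for each $id\in$ Ids broadcast $\langle ECHO,id\rangle$; reset Ids to the set of $id$ for which $\langle ECHO,id\rangle$ was received on at least $N-t$ distinct links. Step 3: for each $id\in$ Ids broadcast $\langle READY,id\rangle$; timely $:=$ set of $id$ for which $\langle READY,id\rangle$ was received on at least $N-t$ distinct links; reset Ids to the set of $id$ for which $\langle READY,id\rangle$ was received on at least $N-2t$ distinct links and for which the process has not broadcast $\langle READY,id\rangle$. Step 4: for each $id\in$ Ids broadcast $\langle READY,id\rangle$; accepted $:=$ set of $id$ for which $\langle READY,id\rangle$ messages (Steps 3 and 4 together) were received on at least $N-t$ distinct links. -}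

module Defs where

open import Data.Nat using (ℕ; zero; suc; _+_; _*_; _∸_; _≤_; _<_)
open import Data.Nat.DivMod using (_/_)
open import Data.Fin using (Fin)
open import Data.Fin.Subset using (Subset; _∈_; _∉_; ∣_∣)
open import Data.Maybe using (Maybe; just)
open import Data.List using (List; length)
open import Data.List.Relation.Unary.All using (All)
open import Data.List.Relation.Unary.Unique.Propositional using (Unique)
open import Data.Product using (Σ; _×_; ∃)
open import Data.Sum using (_⊎_)
open import Relation.Binary.PropositionalEquality using (_≡_)
open import Relation.Nullary using (¬_)

Id : Set
Id = ℕ

-- "P holds on at least k distinct links": there are at least k distinct
-- senders j (each sender corresponds to exactly one incoming link of the
-- receiver) satisfying P.
AtLeast : {N : ℕ} → ℕ → (Fin N → Set) → Set
AtLeast {N} k P = Σ (List (Fin N)) λ l → Unique l × All P l × k ≤ length l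

-- Indices: sender, receiver.
-- Step 1: an ID message carries one identifier; at most one ID message per link.
-- Steps 2–4: a Byzantine sender may send any set of ECHO / READY messages
-- on each link (different ones to different receivers).
record Adversary (N : ℕ) : Set₁ where
  field
    idMsg    : Fin N → Fin N → Maybe Id
    echoMsg  : Fin N → Fin N → Id → Set
    ready3   : Fin N → Fin N → Id → Set
    ready4   : Fin N → Fin N → Id → Set

module Execution {N t : ℕ} (F : Subset N) (myId : Fin N → Id) (adv : Adversary N) where
  open Adversary adv

  -- Step 1: ⟨ID, x⟩ received by i on the link from j
  RecvID : Fin N → Fin N → Id → Set
  RecvID i j x = (j ∉ F × myId j ≡ x) ⊎ (j ∈ F × idMsg j i ≡ just x)

  Ids₁ : Fin N → Id → Set
  Ids₁ i x = ∃ λ j → RecvID i j x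

  RecvEcho : Fin N → Fin N → Id → Set
  RecvEcho i j x = (j ∉ F × Ids₁ j x) ⊎ (j ∈ F × echoMsg j i x)

  Ids₂ : Fin N → Id → Set
  Ids₂ i x = AtLeast (N ∸ t) (λ j → RecvEcho i j x)

  RecvReady₃ : Fin N → Fin N → Id → Set
  RecvReady₃ i j x = (j ∉ F × Ids₂ j x) ⊎ (j ∈ F × ready3 j i x)

  timely : Fin N → Id → Set
  timely i x = AtLeast (N ∸ t) (λ j → RecvReady₃ i j x)

  Ids₃ : Fin N → Id → Set
  Ids₃ i x = AtLeast (N ∸ 2 * t) (λ j → RecvReady₃ i j x) × ¬ Ids₂ i x

  RecvReady₄ : Fin N → Fin N → Id → Set
  RecvReady₄ i j x = (j ∉ F × Ids₃ j x) ⊎ (j ∈ F × ready4 j i x)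

  accepted : Fin N → Id → Set
  accepted i x = AtLeast (N ∸ t) (λ j → RecvReady₃ i j x ⊎ RecvReady₄ i j x)

-- N + ⌊ t² / (N − 2t) ⌋  (the divisor is positive whenever N > 3t; the
-- zero case is never used under the hypotheses of the theorem)
bound : ℕ → ℕ → ℕ
bound N t with N ∸ 2 * t
... | zero  = N
... | suc k = N + (t * t) / suc k

module Submission where

-- Let f = ∣F∣ ≤ t be the number of faulty processes, c = N − f the number of
-- correct ones and d = N − 2t > t.  The identifiers accepted by a correct
-- process split into genuine ones (identifiers of correct processes), of which
-- there are at most c, and forged ones.  An accepted identifier x was put into
-- Ids₂ (the ECHO threshold) by some process, so N − t links echoed x; at least
-- d of them come from correct processes k, and if x is forged each such k
-- received ⟨ID, x⟩ in Step 1 on a link from a faulty process.  A correct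
-- process receives at most f identifiers on faulty links, so double counting
-- the pairs (forged x, correct k) gives b·d ≤ c·f for the number b of forged
-- accepted identifiers.  As c + f = d + 2t we have c·f ≤ f·d + t², hence
-- b ≤ f + ⌊t²/d⌋ and the total is at most c + f + ⌊t²/d⌋ = N + ⌊t²/d⌋.

open import Defs
open import Data.Nat using (ℕ; suc; _+_; _*_; _∸_; _≤_; _<_; z≤n; s≤s; NonZero; >-nonZero)
open import Data.Nat.Properties
open import Data.Nat.DivMod using (_/_; m*n/n≡m; /-monoˡ-≤; +-distrib-/-∣ˡ)
open import Data.Nat.Divisibility using (n∣m*n)
open import Data.Nat.ListAction using (sum)
open import Data.Nat.Tactic.RingSolver using (solve-∀)
open import Data.Fin using (Fin; zero; suc)
open import Data.Fin.Subset using (Subset; inside; outside; ∁; _∉_; ∣_∣) renaming (_∈_ to _∈ₛ_)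
open import Data.Fin.Subset.Properties using (∣∁p∣≡n∸∣p∣; ∣p∣≤n; x∉p⇒x∈∁p) renaming (_∈?_ to _∈ₛ?_)
open import Data.List using (List; []; _∷_; length; map; filter; mapMaybe; _++_)
open import Data.List.Properties using (length-map; length-removeAt′; map-cong; length-mapMaybe; length-++)
open import Data.List.Membership.Propositional using (_∈_; find; lose)
open import Data.List.Membership.Propositional.Properties using (∈-map⁺; ∈-++⁺ˡ; ∈-++⁺ʳ; ∈-filter⁺; ∈-filter⁻)
open import Data.List.Membership.DecPropositional Data.Nat._≟_ using () renaming (_∈?_ to _∈ℕ?_)
open import Data.List.Relation.Binary.Subset.Propositional using (_⊆_)
open import Data.List.Relation.Unary.Any using (here; there; index; _─_; any?)
import Data.List.Relation.Unary.Any as Any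
open import Data.List.Relation.Unary.Any.Properties using (map⁺; mapMaybe⁺)
open import Data.List.Relation.Unary.All as All using (All; []; _∷_)
open import Data.List.Relation.Unary.AllPairs using (_∷_)
open import Data.List.Relation.Unary.Unique.Propositional using (Unique)
open import Data.List.Relation.Unary.Unique.Propositional.Properties using (filter⁺)
open import Data.Maybe using (just)
import Data.Maybe.Relation.Unary.Any as MaybeAny
open import Data.Product using (∃; _×_; _,_; proj₁; proj₂)
open import Data.Sum using (_⊎_; inj₁; inj₂; [_,_]′)
open import Data.Empty using (⊥-elim)
open import Level using (0ℓ)
open import Function using (_∘_)
open import Relation.Nullary using (Dec; yes; no; ¬_; ¬?)
open import Relation.Nullary.Decidable using (decidable-stable)
open import Relation.Unary using (Pred; Decidable)
open import Relation.Unary.Properties using (∁?)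
open import Relation.Binary.PropositionalEquality using (_≡_; _≢_; refl; sym; trans; cong; subst; subst₂)
open import Algebra.Properties.CommutativeSemigroup +-commutativeSemigroup using (interchange)
open import Data.Vec.Base using ([]; _∷_)
import Data.Vec.Base as Vec

indicator : ∀ {P : Set} → Dec P → ℕ
indicator (yes _) = 1
indicator (no  _) = 0

module _ {A : Set} where

  ∈-─ : ∀ {x y} {ys : List A} (x∈ys : x ∈ ys) → y ∈ ys → y ≢ x → y ∈ (ys ─ x∈ys)
  ∈-─ (here refl) (here refl)   y≢x = ⊥-elim (y≢x refl)
  ∈-─ (here refl) (there y∈ys)  _   = y∈ys
  ∈-─ (there _)   (here refl)   _   = here refl
  ∈-─ (there x∈ys) (there y∈ys) y≢x = there (∈-─ x∈ys y∈ys y≢x)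

  unique-⊆⇒length≤ : ∀ {xs ys : List A} → Unique xs → xs ⊆ ys → length xs ≤ length ys
  unique-⊆⇒length≤ {[]}     _               _     = z≤n
  unique-⊆⇒length≤ {x ∷ xs} {ys} (x∉xs ∷ uxs) xs⊆ys = begin
    suc (length xs)           ≤⟨ s≤s (unique-⊆⇒length≤ uxs xs⊆ys─x) ⟩
    suc (length (ys ─ x∈ys))  ≡⟨ sym (length-removeAt′ ys (index x∈ys)) ⟩
    length ys                 ∎
    where
      open ≤-Reasoning
      x∈ys : x ∈ ys
      x∈ys = xs⊆ys (here refl)
      xs⊆ys─x : xs ⊆ (ys ─ x∈ys)
      xs⊆ys─x y∈xs = ∈-─ x∈ys (xs⊆ys (there y∈xs)) (λ y≡x → All.lookup x∉xs y∈xs (sym y≡x))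

  module _ {P : Pred A 0ℓ} (P? : Decidable P) where

    length-filter+filter-∁ : ∀ xs → length (filter P? xs) + length (filter (∁? P?) xs) ≡ length xs
    length-filter+filter-∁ []       = refl
    length-filter+filter-∁ (x ∷ xs) with P? x
    ... | yes _ = cong suc (length-filter+filter-∁ xs)
    ... | no  _ = trans (+-suc _ _) (cong suc (length-filter+filter-∁ xs))

    length-filter≡sum : ∀ xs → length (filter P? xs) ≡ sum (map (indicator ∘ P?) xs)
    length-filter≡sum []       = refl
    length-filter≡sum (x ∷ xs) with P? x
    ... | yes _ = cong suc (length-filter≡sum xs)
    ... | no  _ = length-filter≡sum xs

module _ {C : Set} where

  sum-map-+ : ∀ (g h : C → ℕ) zs → sum (map (λ z → g z + h z) zs) ≡ sum (map g zs) + sum (map h zs)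
  sum-map-+ g h []       = refl
  sum-map-+ g h (z ∷ zs) = trans (cong (g z + h z +_) (sum-map-+ g h zs))
                                 (interchange (g z) (h z) (sum (map g zs)) (sum (map h zs)))

  sum-map-≥ : ∀ (g : C → ℕ) {m} zs → All (λ z → m ≤ g z) zs → length zs * m ≤ sum (map g zs)
  sum-map-≥ g []       []         = z≤n
  sum-map-≥ g (z ∷ zs) (m≤ ∷ m≤s) = +-mono-≤ m≤ (sum-map-≥ g zs m≤s)

  sum-map-≤ : ∀ (g : C → ℕ) {m} zs → All (λ z → g z ≤ m) zs → sum (map g zs) ≤ length zs * m
  sum-map-≤ g []       []         = z≤n
  sum-map-≤ g (z ∷ zs) (≤m ∷ ≤ms) = +-mono-≤ ≤m (sum-map-≤ g zs ≤ms)

sum-swap : ∀ {A B : Set} (g : A → B → ℕ) xs ks →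
           sum (map (λ x → sum (map (g x) ks)) xs) ≡ sum (map (λ k → sum (map (λ x → g x k) xs)) ks)
sum-swap g []       ks = sym (sum-zeros ks)
  where
    sum-zeros : ∀ ks → sum (map (λ _ → 0) ks) ≡ 0
    sum-zeros []       = refl
    sum-zeros (_ ∷ ks) = sum-zeros ks
sum-swap g (x ∷ xs) ks = trans (cong (sum (map (g x) ks) +_) (sum-swap g xs ks))
                               (sym (sum-map-+ (g x) (λ k → sum (map (λ y → g y k) xs)) ks))

double-counting : ∀ {A B : Set} {R : A → B → Set} (R? : ∀ x k → Dec (R x k)) {m e} xs ks →
                  All (λ x → m ≤ length (filter (R? x) ks)) xs →
                  All (λ k → length (filter (λ x → R? x k) xs) ≤ e) ks →
                  length xs * m ≤ length ks * e
double-counting {A} {B} R? {m} {e} xs ks rows cols = begin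
  length xs * m                                                 ≤⟨ sum-map-≥ _ xs rows ⟩
  sum (map (λ x → length (filter (R? x) ks)) xs)                ≡⟨ map-sum (λ x → length-filter≡sum (R? x) ks) xs ⟩
  sum (map (λ x → sum (map (incidence x) ks)) xs)               ≡⟨ sum-swap incidence xs ks ⟩
  sum (map (λ k → sum (map (λ x → incidence x k) xs)) ks)       ≡⟨ map-sum (λ k → sym (length-filter≡sum (λ x → R? x k) xs)) ks ⟩
  sum (map (λ k → length (filter (λ x → R? x k) xs)) ks)        ≤⟨ sum-map-≤ _ ks cols ⟩
  length ks * e                                                 ∎
  where
    open ≤-Reasoning
    incidence : A → B → ℕ
    incidence x k = indicator (R? x k)
    map-sum : ∀ {C : Set} {g h : C → ℕ} → (∀ z → g z ≡ h z) → ∀ zs → sum (map g zs) ≡ sum (map h zs)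
    map-sum g≗h zs = cong sum (map-cong g≗h zs)

members : ∀ {n} → Subset n → List (Fin n)
members []            = []
members (inside  ∷ p) = zero ∷ map suc (members p)
members (outside ∷ p) = map suc (members p)

length-members : ∀ {n} (p : Subset n) → length (members p) ≡ ∣ p ∣
length-members []            = refl
length-members (inside  ∷ p) = cong suc (trans (length-map suc (members p)) (length-members p))
length-members (outside ∷ p) = trans (length-map suc (members p)) (length-members p)

∈-members : ∀ {n} {p : Subset n} {x} → x ∈ₛ p → x ∈ members p
∈-members {p = inside  ∷ p} Vec.here        = here refl
∈-members {p = inside  ∷ p} (Vec.there x∈p) = there (∈-map⁺ suc (∈-members x∈p))
∈-members {p = outside ∷ p} (Vec.there x∈p) = ∈-map⁺ suc (∈-members x∈p)

outside-of : ∀ {n} (F : Subset n) {l : List (Fin n)} → Unique l → ∣ F ∣ < length l → ∃ λ k → k ∈ l × k ∉ F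
outside-of F {l} ul ∣F∣<l with any? (λ k → ¬? (k ∈ₛ? F)) l
... | yes some = find some
... | no  none = ⊥-elim (<⇒≱ ∣F∣<l (begin
  length l          ≤⟨ unique-⊆⇒length≤ ul l⊆F ⟩
  length (members F) ≡⟨ length-members F ⟩
  ∣ F ∣             ∎))
  where
    open ≤-Reasoning
    l⊆F : l ⊆ members F
    l⊆F {k} k∈l = ∈-members (decidable-stable (k ∈ₛ? F) (none ∘ lose k∈l))

2mn≤m²+n² : ∀ m n → 2 * m * n ≤ m * m + n * n
2mn≤m²+n² m n = [ ordered , swapped ]′ (≤-total n m)
  where
    -- for b ≤ a write a = b + o; then a² + b² = 2ab + o².
    ordered : ∀ {a b} → b ≤ a → 2 * a * b ≤ a * a + b * b
    ordered {b = b} b≤a with o , refl ← m≤n⇒∃[o]m+o≡n b≤a = begin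
      2 * (b + o) * b          ≤⟨ m≤m+n _ (o * o) ⟩
      2 * (b + o) * b + o * o  ≡⟨ square b o ⟩
      (b + o) * (b + o) + b * b ∎
      where
        open ≤-Reasoning
        square : ∀ b o → 2 * (b + o) * b + o * o ≡ (b + o) * (b + o) + b * b
        square = solve-∀
    swapped : m ≤ n → 2 * m * n ≤ m * m + n * n
    swapped m≤n = subst₂ _≤_ (2ab≡2ba n m) (+-comm (n * n) (m * m)) (ordered m≤n)
      where
        2ab≡2ba : ∀ a b → 2 * a * b ≡ 2 * b * a
        2ab≡2ba = solve-∀

-- If c + f = d + 2t then c·f ≤ f·d + t²: expand (c + f)·f = d·f + 2tf and use AM–GM.
cf≤fd+t² : ∀ c f d t → c + f ≡ d + 2 * t → c * f ≤ f * d + t * t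
cf≤fd+t² c f d t c+f≡d+2t = +-cancelʳ-≤ (f * f) (c * f) (f * d + t * t) (begin
  c * f + f * f            ≡⟨ sym (*-distribʳ-+ f c f) ⟩
  (c + f) * f              ≡⟨ cong (_* f) c+f≡d+2t ⟩
  (d + 2 * t) * f          ≡⟨ *-distribʳ-+ f d (2 * t) ⟩
  d * f + 2 * t * f        ≤⟨ +-monoʳ-≤ (d * f) (2mn≤m²+n² t f) ⟩
  d * f + (t * t + f * f)  ≡⟨ regroup d f t ⟩
  f * d + t * t + f * f    ∎)
  where
    open ≤-Reasoning
    regroup : ∀ d f t → d * f + (t * t + f * f) ≡ f * d + t * t + f * f
    regroup = solve-∀

≤-divide : ∀ b f T d .{{_ : NonZero d}} → b * d ≤ f * d + T → b ≤ f + T / d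
≤-divide b f T d bd≤fd+T = begin
  b                    ≡⟨ sym (m*n/n≡m b d) ⟩
  b * d / d            ≤⟨ /-monoˡ-≤ d bd≤fd+T ⟩
  (f * d + T) / d      ≡⟨ +-distrib-/-∣ˡ T (n∣m*n f) ⟩
  f * d / d + T / d    ≡⟨ cong (_+ T / d) (m*n/n≡m f d) ⟩
  f + T / d            ∎
  where open ≤-Reasoning

genuine+forged≤ : ∀ a b c f d t .{{_ : NonZero d}} → a ≤ c → b * d ≤ c * f → c + f ≡ d + 2 * t →
                  a + b ≤ c + f + t * t / d
genuine+forged≤ a b c f d t a≤c bd≤cf c+f≡d+2t = begin
  a + b                  ≤⟨ +-mono-≤ a≤c (≤-divide b f (t * t) d (≤-trans bd≤cf (cf≤fd+t² c f d t c+f≡d+2t))) ⟩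
  c + (f + t * t / d)    ≡⟨ sym (+-assoc c f (t * t / d)) ⟩
  c + f + t * t / d      ∎
  where open ≤-Reasoning

bound≡ : ∀ N t .{{_ : NonZero (N ∸ 2 * t)}} → bound N t ≡ N + t * t / (N ∸ 2 * t)
bound≡ N t with N ∸ 2 * t
... | suc _ = refl

module Analysis {N t : ℕ} (F : Subset N) (myId : Fin N → Id) (adv : Adversary N)
                (∣F∣≤t : ∣ F ∣ ≤ t) (3t<N : 3 * t < N) where
  open Adversary adv
  open Execution {N} {t} F myId adv

  d : ℕ
  d = N ∸ 2 * t

  t<d : t < d
  t<d = m+n≤o⇒m≤o∸n (suc t) 3t<N

  instance
    d≢0 : NonZero d
    d≢0 = >-nonZero (≤-<-trans z≤n t<d)

  d+2t≡N : d + 2 * t ≡ N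
  d+2t≡N = m∸n+n≡m (m+n≤o⇒n≤o (suc t) 3t<N)

  ∣∁F∣+∣F∣≡N : ∣ ∁ F ∣ + ∣ F ∣ ≡ N
  ∣∁F∣+∣F∣≡N = trans (cong (_+ ∣ F ∣) (∣∁p∣≡n∸∣p∣ F)) (m∸n+n≡m (∣p∣≤n F))

  ∣F∣<d : ∣ F ∣ < d
  ∣F∣<d = ≤-<-trans ∣F∣≤t t<d

  ∣F∣<N∸t : ∣ F ∣ < N ∸ t
  ∣F∣<N∸t = <-≤-trans ∣F∣<d (∸-monoʳ-≤ N (m≤m+n t _))

  faulty correct : List (Fin N)
  faulty  = members F
  correct = members (∁ F)

  correct-sender : ∀ {m} {P : Fin N → Set} → ∣ F ∣ < m → AtLeast m P → ∃ λ k → k ∉ F × P k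
  correct-sender ∣F∣<m (l , ul , Pl , m≤l) with outside-of F ul (<-≤-trans ∣F∣<m m≤l)
  ... | k , k∈l , k∉F = k , k∉F , All.lookup Pl k∈l

  prescribed : ∀ {k} {A B : Set} → k ∉ F → (k ∉ F × A) ⊎ (k ∈ₛ F × B) → A
  prescribed _   (inj₁ (_ , a))   = a
  prescribed k∉F (inj₂ (k∈F , _)) = ⊥-elim (k∉F k∈F)

  -- An accepted identifier passed the ECHO threshold (Step 2) at some process:
  -- its acceptance needs a correct READY sender, directly in Step 3 or via
  -- N − 2t Step-3 READY messages in Step 4.
  accepted⇒Ids₂ : ∀ {i x} → accepted i x → ∃ λ j → Ids₂ j x
  accepted⇒Ids₂ acc with correct-sender ∣F∣<N∸t acc
  ... | k , k∉F , inj₁ ready₃ = k , prescribed k∉F ready₃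
  ... | k , k∉F , inj₂ ready₄ with correct-sender ∣F∣<d (proj₁ (prescribed k∉F ready₄))
  ...   | k′ , k′∉F , ready₃′ = k′ , prescribed k′∉F ready₃′

  Genuine : Id → Set
  Genuine x = x ∈ map myId correct

  genuine? : Decidable Genuine
  genuine? x = x ∈ℕ? map myId correct

  -- The identifiers process k receives in Step 1 on links from faulty processes:
  -- at most one per faulty process.
  forgedAt : Fin N → List Id
  forgedAt k = mapMaybe (λ j → idMsg j k) faulty

  length-forgedAt : ∀ k → length (forgedAt k) ≤ ∣ F ∣
  length-forgedAt k = ≤-trans (length-mapMaybe (λ j → idMsg j k) faulty) (≤-reflexive (length-members F))

  ∈-forgedAt : ∀ {j k x} → j ∈ₛ F → idMsg j k ≡ just x → x ∈ forgedAt k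
  ∈-forgedAt {j} {k} {x} j∈F idMsg≡x =
    mapMaybe⁺ (λ j′ → idMsg j′ k) faulty (map⁺ (Any.map carries (∈-members j∈F)))
    where
      carries : ∀ {j′} → j ≡ j′ → MaybeAny.Any (x ≡_) (idMsg j′ k)
      carries refl = subst (MaybeAny.Any (x ≡_)) (sym idMsg≡x) (MaybeAny.just refl)

  Ids₁⇒forgedAt : ∀ {k x} → ¬ Genuine x → Ids₁ k x → x ∈ forgedAt k
  Ids₁⇒forgedAt ¬genuine (j , inj₁ (j∉F , refl)) = ⊥-elim (¬genuine (∈-map⁺ myId (∈-members (x∉p⇒x∈∁p j∉F))))
  Ids₁⇒forgedAt _        (j , inj₂ (j∈F , idMsg≡x)) = ∈-forgedAt j∈F idMsg≡x

  -- A non-genuine accepted identifier x lies in forgedAt k for at least d correct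
  -- processes k: some process received N − t ECHOs of x, at most t of them from
  -- faulty processes, and a correct sender k had x in Ids₁ k.
  forged-support : ∀ {i x} → ¬ Genuine x → accepted i x →
                   d ≤ length (filter (λ k → x ∈ℕ? forgedAt k) correct)
  forged-support {x = x} ¬genuine acc with accepted⇒Ids₂ acc
  ... | _ , (l , ul , echoes , N∸t≤l) = begin
    d              ≡⟨ cong (λ s → N ∸ (t + s)) (+-identityʳ t) ⟩
    N ∸ (t + t)    ≡⟨ sym (∸-+-assoc N t t) ⟩
    N ∸ t ∸ t      ≤⟨ ∸-monoˡ-≤ t N∸t≤L+t ⟩
    L + t ∸ t      ≡⟨ m+n∸n≡m L t ⟩
    L              ∎
    where
      open ≤-Reasoning
      witnesses : List (Fin N)
      witnesses = filter (λ k → x ∈ℕ? forgedAt k) correct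
      L : ℕ
      L = length witnesses
      echoers⊆ : l ⊆ witnesses ++ faulty
      echoers⊆ {k} k∈l with All.lookup echoes k∈l
      ... | inj₁ (k∉F , ids₁) = ∈-++⁺ˡ (∈-filter⁺ _ (∈-members (x∉p⇒x∈∁p k∉F)) (Ids₁⇒forgedAt ¬genuine ids₁))
      ... | inj₂ (k∈F , _)    = ∈-++⁺ʳ witnesses (∈-members k∈F)
      N∸t≤L+t : N ∸ t ≤ L + t
      N∸t≤L+t = begin
        N ∸ t                      ≤⟨ N∸t≤l ⟩
        length l                   ≤⟨ unique-⊆⇒length≤ ul echoers⊆ ⟩
        length (witnesses ++ faulty) ≡⟨ length-++ witnesses ⟩
        L + length faulty          ≡⟨ cong (L +_) (length-members F) ⟩
        L + ∣ F ∣                  ≤⟨ +-monoʳ-≤ L ∣F∣≤t ⟩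
        L + t                      ∎

  genuine-count : ∀ xs → Unique xs → All Genuine xs → length xs ≤ ∣ ∁ F ∣
  genuine-count xs uxs genuine = begin
    length xs                  ≤⟨ unique-⊆⇒length≤ uxs (All.lookup genuine) ⟩
    length (map myId correct)  ≡⟨ length-map myId correct ⟩
    length correct             ≡⟨ length-members (∁ F) ⟩
    ∣ ∁ F ∣                    ∎
    where open ≤-Reasoning

  -- Double counting the pairs (x, k) with x ∈ forgedAt k, for k correct and x a
  -- forged accepted identifier: each x has at least d such k, each k at most ∣F∣ such x.
  forged-count : ∀ {i} xs → Unique xs → All (λ x → ¬ Genuine x × accepted i x) xs →
                 length xs * d ≤ ∣ ∁ F ∣ * ∣ F ∣
  forged-count xs uxs forged = begin
    length xs * d           ≤⟨ double-counting (λ x k → x ∈ℕ? forgedAt k) xs correct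
                                 (All.map (λ (¬genuine , acc) → forged-support ¬genuine acc) forged)
                                 (All.tabulate (λ {k} _ → at-most-∣F∣ k)) ⟩
    length correct * ∣ F ∣  ≡⟨ cong (_* ∣ F ∣) (length-members (∁ F)) ⟩
    ∣ ∁ F ∣ * ∣ F ∣         ∎
    where
      open ≤-Reasoning
      at-most-∣F∣ : ∀ k → length (filter (λ x → x ∈ℕ? forgedAt k) xs) ≤ ∣ F ∣
      at-most-∣F∣ k = ≤-trans (unique-⊆⇒length≤ (filter⁺ _ uxs) (proj₂ ∘ ∈-filter⁻ _ {xs = xs}))
                              (length-forgedAt k)

  accepted-bound : ∀ {i} xs → Unique xs → All (accepted i) xs → length xs ≤ N + t * t / d
  accepted-bound xs uxs accepted-xs = begin
    length xs                    ≡⟨ sym (length-filter+filter-∁ genuine? xs) ⟩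
    length gs + length fs        ≤⟨ genuine+forged≤ _ _ _ _ d t
                                      (genuine-count gs (filter⁺ genuine? uxs) gs-genuine)
                                      (forged-count fs (filter⁺ (∁? genuine?) uxs) fs-forged)
                                      (trans ∣∁F∣+∣F∣≡N (sym d+2t≡N)) ⟩
    ∣ ∁ F ∣ + ∣ F ∣ + t * t / d  ≡⟨ cong (_+ t * t / d) ∣∁F∣+∣F∣≡N ⟩
    N + t * t / d                ∎
    where
      open ≤-Reasoning
      gs fs : List Id
      gs = filter genuine? xs
      fs = filter (∁? genuine?) xs
      gs-genuine : All Genuine gs
      gs-genuine = All.tabulate (proj₂ ∘ ∈-filter⁻ genuine? {xs = xs})
      fs-forged : All (λ x → ¬ Genuine x × _) fs
      fs-forged = All.tabulate λ x∈fs → let (x∈xs , ¬genuine) = ∈-filter⁻ (∁? genuine?) {xs = xs} x∈fs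
                                        in ¬genuine , All.lookup accepted-xs x∈xs

lemma3 : (N t : ℕ) → 3 * t < N
    → (F : Subset N) → ∣ F ∣ ≤ t
    → (myId : Fin N → Id)
    → (∀ i j → i ∉ F → j ∉ F → myId i ≡ myId j → i ≡ j)
    → (adv : Adversary N)
    → (i : Fin N) → i ∉ F
    → (xs : List Id) → Unique xs
    → All (Execution.accepted {N} {t} F myId adv i) xs
    → length xs ≤ bound N t
lemma3 N t 3t<N F ∣F∣≤t myId _ adv i _ xs uxs accepted-xs = begin
  length xs                     ≤⟨ accepted-bound xs uxs accepted-xs ⟩
  N + t * t / (N ∸ 2 * t)       ≡⟨ sym (bound≡ N t) ⟩
  bound N t                     ∎
  where
    open ≤-Reasoning
    open Analysis F myId adv ∣F∣≤t 3t<N
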